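{- For a finite group $G$, the following are equivalent: (a) the power graph of $G$ is equal to the conjugacy superpower graph of $G$; (b) the enhanced power graph of $G$ is equal to the conjugacy superenhanced power graph of $G$; (c) $G$ is a Dedekind group (every subgroup of $G$ is normal).
   Context: For a finite group $G$: the power graph has vertex set $G$, with distinct $g,h$ adjacent iff one is a power of the other; the enhanced power graph has vertex set $G$, with distinct $g,h$ adjacent iff $\langle g,h\rangle$ is cyclic. For such a graph $\mathrm{A}$, the conjugacy super$\mathrm{A}$ graph has vertex set $G$, with distinct $g,h$ adjacent iff there exist a conjugate $g'$ of $g$ and a conjugate $h'$ of $h$ that are equal or adjacent in $\mathrm{A}$ (so each conjugacy class induces a complete subgraph). -}

module Defs where

open import Level using (Level; _⊔_; suc)
open import Algebra.Bundles using (Group)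
open import Data.Nat using (ℕ; zero) renaming (suc to sucℕ)
open import Data.Integer using (ℤ; +_; -[1+_])
open import Data.Fin using (Fin)
open import Data.Product using (Σ; ∃; _×_; _,_)
open import Data.Sum using (_⊎_)
open import Relation.Nullary using (¬_)
open import Relation.Binary.Definitions using (Decidable)

-- A finite group: a group (with setoid equality) whose carrier is
-- enumerated (up to ≈) by Fin n for some n, and whose equality is
-- decidable (automatic classically for finite sets).
record FiniteGroup (c ℓ : Level) : Set (suc (c ⊔ ℓ)) where
  field
    group : Group c ℓ
  open Group group public
  field
    size  : ℕ
    enum  : Fin size → Carrier
    enum-surjective : ∀ x → ∃ λ i → enum i ≈ x
    _≟_   : Decidable _≈_

module _ {c ℓ : Level} (G : FiniteGroup c ℓ) where
  open FiniteGroup G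

  powℕ : Carrier → ℕ → Carrier
  powℕ g zero = ε
  powℕ g (sucℕ n) = g ∙ powℕ g n

  powℤ : Carrier → ℤ → Carrier
  powℤ g (+ n) = powℕ g n
  powℤ g -[1+ n ] = (powℕ g (sucℕ n)) ⁻¹

  IsPowerOf : Carrier → Carrier → Set ℓ
  IsPowerOf h g = ∃ λ (k : ℤ) → h ≈ powℤ g k

  data InGen (g h : Carrier) : Carrier → Set (c ⊔ ℓ) where
    gen₁ : ∀ {x} → x ≈ g → InGen g h x
    gen₂ : ∀ {x} → x ≈ h → InGen g h x
    genε : ∀ {x} → x ≈ ε → InGen g h x
    gen∙ : ∀ {x y z} → InGen g h x → InGen g h y → z ≈ x ∙ y → InGen g h z
    gen⁻¹ : ∀ {x z} → InGen g h x → z ≈ x ⁻¹ → InGen g h z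

  GenCyclic : Carrier → Carrier → Set (c ⊔ ℓ)
  GenCyclic g h = Σ Carrier λ z → InGen g h z × (∀ x → InGen g h x → IsPowerOf x z)

  IsConjugate : Carrier → Carrier → Set (c ⊔ ℓ)
  IsConjugate x g = ∃ λ y → x ≈ (y ∙ g) ∙ (y ⁻¹)

  PowerRel : Carrier → Carrier → Set ℓ
  PowerRel g h = IsPowerOf g h ⊎ IsPowerOf h g

  EnhancedRel : Carrier → Carrier → Set (c ⊔ ℓ)
  EnhancedRel g h = GenCyclic g h

  Adj : ∀ {r} → (Carrier → Carrier → Set r) → Carrier → Carrier → Set (ℓ ⊔ r)
  Adj R g h = ¬ (g ≈ h) × R g h

  SuperAdj : ∀ {r} → (Carrier → Carrier → Set r) → Carrier → Carrier → Set (c ⊔ ℓ ⊔ r)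
  SuperAdj R g h = ¬ (g ≈ h) × (Σ Carrier λ g′ → Σ Carrier λ h′ →
    IsConjugate g′ g × IsConjugate h′ h × (g′ ≈ h′ ⊎ Adj R g′ h′))

  SameGraph : ∀ {r s} → (Carrier → Carrier → Set r) → (Carrier → Carrier → Set s) → Set (c ⊔ r ⊔ s)
  SameGraph A B = ∀ g h → (A g h → B g h) × (B g h → A g h)

  PowerGraph≡SuperPowerGraph : Set (c ⊔ ℓ)
  PowerGraph≡SuperPowerGraph = SameGraph (Adj PowerRel) (SuperAdj PowerRel)

  EnhancedPowerGraph≡SuperEnhancedPowerGraph : Set (c ⊔ ℓ)
  EnhancedPowerGraph≡SuperEnhancedPowerGraph = SameGraph (Adj EnhancedRel) (SuperAdj EnhancedRel)

  record IsSubgroup (H : Carrier → Set (c ⊔ ℓ)) : Set (c ⊔ ℓ) where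
    field
      resp  : ∀ {x y} → x ≈ y → H x → H y
      has-ε : H ε
      ∙-closed : ∀ {x y} → H x → H y → H (x ∙ y)
      ⁻¹-closed : ∀ {x} → H x → H (x ⁻¹)

  IsNormal : (Carrier → Set (c ⊔ ℓ)) → Set (c ⊔ ℓ)
  IsNormal H = ∀ x g → H g → H ((x ∙ g) ∙ (x ⁻¹))

  IsDedekind : Set (suc (c ⊔ ℓ))
  IsDedekind = ∀ (H : Carrier → Set (c ⊔ ℓ)) → IsSubgroup H → IsNormal H

-- Both conjugacy super graphs contain their base graphs. If every cyclic subgroup is normal
-- (equivalently, G is Dedekind), conjugate elements generate the same cyclic subgroup, so
-- replacing vertices by conjugates changes neither the power relation nor the enhanced power
-- relation, and the graphs coincide. Conversely, if a graph equals its super graph then g and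
-- x g x⁻¹ are equal or adjacent, being conjugate. In the power graph one of them is then a power
-- of the other, and g ∈ ⟨x g x⁻¹⟩ still forces x g x⁻¹ ∈ ⟨g⟩: conjugation by x⁻¹ maps ⟨g⟩
-- into itself, hence so does conjugation by x, a power of x⁻¹. In the enhanced power graph both
-- lie in one cyclic group and have the same order, and in a cyclic group every element whose
-- order divides that of g lies in ⟨g⟩.

module Submission where

open import Defs
open import Level using (Level; _⊔_)
open import Function using (id; _∘_)
open import Data.Product using (_×_; _,_; ∃; proj₁; proj₂)
open import Data.Sum as Sum using (_⊎_; inj₁; inj₂; [_,_]′)
open import Data.Nat using (ℕ; zero; suc; _+_; _*_; _<_; s≤s; _%_; _/_)
open import Data.Nat.Properties using (+-suc; n<1+n; m≤n⇒∃[o]m+o≡n; anyUpTo?)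
open import Data.Nat.DivMod using (m≡m%n+[m/n]*n; m%n<n)
open import Data.Nat.Divisibility
  using (_∣_; divides; quotient; m%n≡0⇒n∣m; *-monoʳ-∣; *-cancelˡ-∣; quotient≢0; m∣n⇒n≡quotient*m)
open import Data.Nat.GCD using (gcd; gcd[m,n]∣m; gcd[m,n]∣n; gcd-GCD; module Bézout)
open import Data.Nat.Induction using (<-rec)
open import Data.Fin using (toℕ)
open import Data.Fin.Properties using (pigeonhole)
open import Data.Integer using (+_; -[1+_])
open import Relation.Nullary using (¬_; yes; no)
open import Data.Empty using (⊥-elim)
open import Relation.Unary using (Pred; Decidable; _⊆_)
import Relation.Binary.PropositionalEquality as ≡

IsLeast : ∀ {p} → Pred ℕ p → ℕ → Set p
IsLeast P m = P m × (∀ {k} → k < m → ¬ P k)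

least-witness : ∀ {p} {P : Pred ℕ p} → Decidable P → ∀ {n} → P n → ∃ (IsLeast P)
least-witness {P = P} P? {n} = <-rec (λ n → P n → ∃ (IsLeast P)) step n
  where
  step : ∀ n → (∀ {k} → k < n → P k → ∃ (IsLeast P)) → P n → ∃ (IsLeast P)
  step n below Pn with anyUpTo? P? n
  ... | yes (k , k<n , Pk) = below k<n Pk
  ... | no none            = n , Pn , λ k<n Pk → none (_ , k<n , Pk)

module Properties {c ℓ : Level} (G : FiniteGroup c ℓ) where
  open FiniteGroup G
  open import Algebra.Properties.Group group
    using (identityʳ-unique; inverseˡ-unique; inverseʳ-unique; ε⁻¹≈ε; ⁻¹-involutive; ⁻¹-anti-homo-∙)
  open import Algebra.Properties.Monoid.Mult monoid
    using (×-congʳ; ×-homo-+; ×-assocˡ) renaming (_×_ to _·_)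
  open import Relation.Binary.Reasoning.Setoid setoid

  infixr 8 _^_
  _^_ : Carrier → ℕ → Carrier
  g ^ n = n · g

  powℕ≡^ : ∀ g n → powℕ G g n ≡.≡ g ^ n
  powℕ≡^ g zero    = ≡.refl
  powℕ≡^ g (suc n) = ≡.cong (g ∙_) (powℕ≡^ g n)

  ^-cong : ∀ n {x y} → x ≈ y → x ^ n ≈ y ^ n
  ^-cong = ×-congʳ

  ^-+ : ∀ g m n → g ^ (m + n) ≈ g ^ m ∙ g ^ n
  ^-+ = ×-homo-+

  ^-* : ∀ g m n → (g ^ m) ^ n ≈ g ^ (n * m)
  ^-* g m n = ×-assocˡ g n m

  ε^ : ∀ n → ε ^ n ≈ ε
  ε^ zero    = refl
  ε^ (suc n) = trans (identityˡ _) (ε^ n)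

  ^-∣ : ∀ {g m n} → g ^ m ≈ ε → m ∣ n → g ^ n ≈ ε
  ^-∣ {g} {m} gᵐ≈ε (divides q ≡.refl) = begin
    g ^ (q * m)   ≈⟨ ^-* g m q ⟨
    (g ^ m) ^ q   ≈⟨ ^-cong q gᵐ≈ε ⟩
    ε ^ q         ≈⟨ ε^ q ⟩
    ε             ∎

  exponent : ∀ z → ∃ λ n → z ^ suc n ≈ ε
  exponent z with pigeonhole (n<1+n size) (λ i → proj₁ (enum-surjective (z ^ toℕ i)))
  ... | i , j , i<j , same-index with m≤n⇒∃[o]m+o≡n i<j
  ... | k , i+k+1≡j = k , identityʳ-unique (z ^ toℕ i) (z ^ suc k) (begin
    z ^ toℕ i ∙ z ^ suc k   ≈⟨ ^-+ z (toℕ i) (suc k) ⟨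
    z ^ (toℕ i + suc k)     ≡⟨ ≡.cong (z ^_) (≡.trans (+-suc (toℕ i) k) i+k+1≡j) ⟩
    z ^ toℕ j               ≈⟨ proj₂ (enum-surjective (z ^ toℕ j)) ⟨
    enum _                  ≡⟨ ≡.cong enum same-index ⟨
    enum _                  ≈⟨ proj₂ (enum-surjective (z ^ toℕ i)) ⟩
    z ^ toℕ i               ∎)

  ⁻¹-as-power : ∀ z → ∃ λ n → z ⁻¹ ≈ z ^ n
  ⁻¹-as-power z with exponent z
  ... | n , zⁿ⁺¹≈ε = n , sym (inverseʳ-unique z (z ^ n) zⁿ⁺¹≈ε)

  ^-% : ∀ {z} n k → z ^ suc n ≈ ε → z ^ (k % suc n) ≈ z ^ k
  ^-% {z} n k zᴺ≈ε = begin
    z ^ (k % suc n)                             ≈⟨ identityʳ _ ⟨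
    z ^ (k % suc n) ∙ ε                         ≈⟨ ∙-congˡ (^-∣ zᴺ≈ε (divides (k / suc n) ≡.refl)) ⟨
    z ^ (k % suc n) ∙ z ^ (k / suc n * suc n)   ≈⟨ ^-+ z (k % suc n) _ ⟨
    z ^ (k % suc n + k / suc n * suc n)         ≡⟨ ≡.cong (z ^_) (m≡m%n+[m/n]*n k (suc n)) ⟨
    z ^ k                                       ∎

  order : ∀ z → ∃ λ n → z ^ suc n ≈ ε × (∀ {k} → z ^ k ≈ ε → suc n ∣ k)
  order z with e , zᵉ⁺¹≈ε ← exponent z
          with n , zᴺ≈ε , minimal ← least-witness (λ n → (z ^ suc n) ≟ ε) {e} zᵉ⁺¹≈ε =
    n , zᴺ≈ε , divides-exponent
    where
    divides-exponent : ∀ {k} → z ^ k ≈ ε → suc n ∣ k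
    divides-exponent {k} zᵏ≈ε with k % suc n in k%N≡ | ^-% n k zᴺ≈ε | m%n<n k (suc n)
    ... | zero  | _        | _       = m%n≡0⇒n∣m k (suc n) k%N≡
    ... | suc r | zʳ⁺¹≈zᵏ | s≤s r<n = ⊥-elim (minimal r<n (trans zʳ⁺¹≈zᵏ zᵏ≈ε))

  conj : Carrier → Carrier → Carrier
  conj x g = x ∙ g ∙ x ⁻¹

  conj-congˡ : ∀ {x y} g → x ≈ y → conj x g ≈ conj y g
  conj-congˡ g x≈y = ∙-cong (∙-congʳ x≈y) (⁻¹-cong x≈y)

  conj-congʳ : ∀ x {g h} → g ≈ h → conj x g ≈ conj x h
  conj-congʳ x g≈h = ∙-congʳ (∙-congˡ g≈h)

  conj-∙ : ∀ x g h → conj x (g ∙ h) ≈ conj x g ∙ conj x h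
  conj-∙ x g h = begin
    x ∙ (g ∙ h) ∙ x ⁻¹                    ≈⟨ ∙-congʳ (∙-congˡ (∙-congʳ (identityʳ g))) ⟨
    x ∙ (g ∙ ε ∙ h) ∙ x ⁻¹                ≈⟨ ∙-congʳ (∙-congˡ (∙-congʳ (∙-congˡ (inverseˡ x)))) ⟨
    x ∙ (g ∙ (x ⁻¹ ∙ x) ∙ h) ∙ x ⁻¹       ≈⟨ ∙-congʳ (∙-congˡ (∙-congʳ (assoc g (x ⁻¹) x))) ⟨
    x ∙ (g ∙ x ⁻¹ ∙ x ∙ h) ∙ x ⁻¹         ≈⟨ ∙-congʳ (∙-congˡ (assoc (g ∙ x ⁻¹) x h)) ⟩
    x ∙ (g ∙ x ⁻¹ ∙ (x ∙ h)) ∙ x ⁻¹       ≈⟨ ∙-congʳ (assoc x (g ∙ x ⁻¹) (x ∙ h)) ⟨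
    x ∙ (g ∙ x ⁻¹) ∙ (x ∙ h) ∙ x ⁻¹       ≈⟨ assoc _ _ _ ⟩
    x ∙ (g ∙ x ⁻¹) ∙ (x ∙ h ∙ x ⁻¹)       ≈⟨ ∙-congʳ (assoc x g (x ⁻¹)) ⟨
    x ∙ g ∙ x ⁻¹ ∙ (x ∙ h ∙ x ⁻¹)         ∎

  conj-ε : ∀ x → conj x ε ≈ ε
  conj-ε x = trans (∙-congʳ (identityʳ x)) (inverseʳ x)

  conj-⁻¹ : ∀ x g → conj x (g ⁻¹) ≈ conj x g ⁻¹
  conj-⁻¹ x g = inverseʳ-unique (conj x g) (conj x (g ⁻¹))
    (trans (sym (conj-∙ x g (g ⁻¹))) (trans (conj-congʳ x (inverseʳ g)) (conj-ε x)))

  conj-^ : ∀ x g n → conj x (g ^ n) ≈ conj x g ^ n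
  conj-^ x g zero    = conj-ε x
  conj-^ x g (suc n) = trans (conj-∙ x g (g ^ n)) (∙-congˡ (conj-^ x g n))

  conj-identity : ∀ g → conj ε g ≈ g
  conj-identity g = trans (∙-cong (identityˡ g) ε⁻¹≈ε) (identityʳ g)

  conj-∘ : ∀ x y g → conj x (conj y g) ≈ conj (x ∙ y) g
  conj-∘ x y g = begin
    x ∙ (y ∙ g ∙ y ⁻¹) ∙ x ⁻¹    ≈⟨ ∙-congʳ (assoc x (y ∙ g) (y ⁻¹)) ⟨
    x ∙ (y ∙ g) ∙ y ⁻¹ ∙ x ⁻¹    ≈⟨ assoc _ _ _ ⟩
    x ∙ (y ∙ g) ∙ (y ⁻¹ ∙ x ⁻¹)  ≈⟨ ∙-cong (assoc x y g) (⁻¹-anti-homo-∙ x y) ⟨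
    x ∙ y ∙ g ∙ (x ∙ y) ⁻¹       ∎

  conj-⁻¹-conj : ∀ x g → conj (x ⁻¹) (conj x g) ≈ g
  conj-⁻¹-conj x g = trans (conj-∘ (x ⁻¹) x g) (trans (conj-congˡ g (inverseˡ x)) (conj-identity g))

  InGen-isSubgroup : ∀ {a b} → IsSubgroup G (InGen G a b)
  InGen-isSubgroup = record
    { resp      = λ x≈y x∈ → gen∙ x∈ (genε refl) (trans (sym x≈y) (sym (identityʳ _)))
    ; has-ε     = genε refl
    ; ∙-closed  = λ x∈ y∈ → gen∙ x∈ y∈ refl
    ; ⁻¹-closed = λ x∈ → gen⁻¹ x∈ refl
    }

  InGen-least : ∀ {H a b} → IsSubgroup G H → H a → H b → InGen G a b ⊆ H
  InGen-least {H} {a} {b} S a∈H b∈H = least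
    where
    open IsSubgroup S
    least : InGen G a b ⊆ H
    least (gen₁ x≈a)     = resp (sym x≈a) a∈H
    least (gen₂ x≈b)     = resp (sym x≈b) b∈H
    least (genε x≈ε)     = resp (sym x≈ε) has-ε
    least (gen∙ u∈ v∈ p) = resp (sym p) (∙-closed (least u∈) (least v∈))
    least (gen⁻¹ u∈ p)   = resp (sym p) (⁻¹-closed (least u∈))

  InGen-conj : ∀ x {a b t} → InGen G a b t → InGen G (conj x a) (conj x b) (conj x t)
  InGen-conj x (gen₁ t≈a)     = gen₁ (conj-congʳ x t≈a)
  InGen-conj x (gen₂ t≈b)     = gen₂ (conj-congʳ x t≈b)
  InGen-conj x (genε t≈ε)     = genε (trans (conj-congʳ x t≈ε) (conj-ε x))
  InGen-conj x (gen∙ u∈ v∈ p) =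
    gen∙ (InGen-conj x u∈) (InGen-conj x v∈) (trans (conj-congʳ x p) (conj-∙ x _ _))
  InGen-conj x (gen⁻¹ u∈ p)   = gen⁻¹ (InGen-conj x u∈) (trans (conj-congʳ x p) (conj-⁻¹ x _))

  ^-closed : ∀ {H g} → IsSubgroup G H → H g → ∀ n → H (g ^ n)
  ^-closed S g∈H zero    = IsSubgroup.has-ε S
  ^-closed S g∈H (suc n) = IsSubgroup.∙-closed S g∈H (^-closed S g∈H n)

  infix 4 _∈⟨_⟩
  _∈⟨_⟩ : Carrier → Carrier → Set (c ⊔ ℓ)
  x ∈⟨ g ⟩ = InGen G g g x

  ∈⟨⟩-refl : ∀ g → g ∈⟨ g ⟩
  ∈⟨⟩-refl g = gen₁ refl

  ∈⟨⟩-resp : ∀ {g x y} → x ≈ y → x ∈⟨ g ⟩ → y ∈⟨ g ⟩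
  ∈⟨⟩-resp = IsSubgroup.resp InGen-isSubgroup

  ∈⟨⟩-trans : ∀ {x y z} → x ∈⟨ y ⟩ → y ∈⟨ z ⟩ → x ∈⟨ z ⟩
  ∈⟨⟩-trans x∈ y∈ = InGen-least InGen-isSubgroup y∈ y∈ x∈

  ^∈⟨⟩ : ∀ g n → g ^ n ∈⟨ g ⟩
  ^∈⟨⟩ g = ^-closed InGen-isSubgroup (∈⟨⟩-refl g)

  ∈⟨⟩⇒^ : ∀ {g x} → x ∈⟨ g ⟩ → ∃ λ n → x ≈ g ^ n
  ∈⟨⟩⇒^ {g} (gen₁ x≈g)     = 1 , trans x≈g (sym (identityʳ g))
  ∈⟨⟩⇒^ {g} (gen₂ x≈g)     = 1 , trans x≈g (sym (identityʳ g))
  ∈⟨⟩⇒^ {g} (genε x≈ε)     = 0 , x≈ε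
  ∈⟨⟩⇒^ {g} (gen∙ u∈ v∈ p) with m , u≈gᵐ ← ∈⟨⟩⇒^ u∈ | n , v≈gⁿ ← ∈⟨⟩⇒^ v∈ =
    m + n , trans p (trans (∙-cong u≈gᵐ v≈gⁿ) (sym (^-+ g m n)))
  ∈⟨⟩⇒^ {g} (gen⁻¹ u∈ p) with m , u≈gᵐ ← ∈⟨⟩⇒^ u∈ with k , gᵐ⁻¹≈gᵐᵏ ← ⁻¹-as-power (g ^ m) =
    k * m , trans p (trans (⁻¹-cong u≈gᵐ) (trans gᵐ⁻¹≈gᵐᵏ (^-* g m k)))

  IsPowerOf⇒∈⟨⟩ : ∀ {g x} → IsPowerOf G x g → x ∈⟨ g ⟩
  IsPowerOf⇒∈⟨⟩ {g} (+ n , x≈gⁿ)     = ∈⟨⟩-resp (sym (trans x≈gⁿ (reflexive (powℕ≡^ g n)))) (^∈⟨⟩ g n)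
  IsPowerOf⇒∈⟨⟩ {g} (-[1+ n ] , x≈gⁿ) =
    gen⁻¹ (^∈⟨⟩ g (suc n)) (trans x≈gⁿ (⁻¹-cong (reflexive (powℕ≡^ g (suc n)))))

  ∈⟨⟩⇒IsPowerOf : ∀ {g x} → x ∈⟨ g ⟩ → IsPowerOf G x g
  ∈⟨⟩⇒IsPowerOf {g} x∈ with n , x≈gⁿ ← ∈⟨⟩⇒^ x∈ = + n , trans x≈gⁿ (reflexive (≡.sym (powℕ≡^ g n)))

  conj-^-∈⟨⟩ : ∀ {w g} → conj w g ∈⟨ g ⟩ → ∀ j → conj (w ^ j) g ∈⟨ g ⟩
  conj-^-∈⟨⟩ {w} {g} wgw⁻¹∈ zero    = ∈⟨⟩-resp (sym (conj-identity g)) (∈⟨⟩-refl g)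
  conj-^-∈⟨⟩ {w} {g} wgw⁻¹∈ (suc j) =
    ∈⟨⟩-resp (conj-∘ w (w ^ j) g) (∈⟨⟩-trans (InGen-conj w (conj-^-∈⟨⟩ wgw⁻¹∈ j)) wgw⁻¹∈)

  conj⁻¹-∈⟨⟩ : ∀ {w g} → conj w g ∈⟨ g ⟩ → conj (w ⁻¹) g ∈⟨ g ⟩
  conj⁻¹-∈⟨⟩ {w} {g} wgw⁻¹∈ with k , w⁻¹≈wᵏ ← ⁻¹-as-power w =
    ∈⟨⟩-resp (conj-congˡ g (sym w⁻¹≈wᵏ)) (conj-^-∈⟨⟩ wgw⁻¹∈ k)

  ∈⟨conj⟩⇒conj∈⟨⟩ : ∀ {x g} → g ∈⟨ conj x g ⟩ → conj x g ∈⟨ g ⟩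
  ∈⟨conj⟩⇒conj∈⟨⟩ {x} {g} g∈ = ∈⟨⟩-resp (conj-congˡ g (⁻¹-involutive x)) (conj⁻¹-∈⟨⟩ x⁻¹gx∈)
    where
    x⁻¹gx∈ : conj (x ⁻¹) g ∈⟨ g ⟩
    x⁻¹gx∈ = ∈⟨⟩-trans (InGen-conj (x ⁻¹) g∈) (∈⟨⟩-resp (sym (conj-⁻¹-conj x g)) (∈⟨⟩-refl g))

  gcd-power∈⟨power⟩ : ∀ {z N} a → z ^ N ≈ ε → z ^ gcd a N ∈⟨ z ^ a ⟩
  gcd-power∈⟨power⟩ {z} {N} a zᴺ≈ε with Bézout.identity (gcd-GCD a N)
  ... | Bézout.+- x y d+yN≡xa = ∈⟨⟩-resp (begin
    (z ^ a) ^ x                  ≈⟨ ^-* z a x ⟩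
    z ^ (x * a)                  ≡⟨ ≡.cong (z ^_) d+yN≡xa ⟨
    z ^ (gcd a N + y * N)        ≈⟨ ^-+ z (gcd a N) (y * N) ⟩
    z ^ gcd a N ∙ z ^ (y * N)    ≈⟨ ∙-congˡ (^-∣ zᴺ≈ε (divides y ≡.refl)) ⟩
    z ^ gcd a N ∙ ε              ≈⟨ identityʳ _ ⟩
    z ^ gcd a N                  ∎) (^∈⟨⟩ (z ^ a) x)
  ... | Bézout.-+ x y d+xa≡yN = gen⁻¹ (^∈⟨⟩ (z ^ a) x) (inverseˡ-unique (z ^ gcd a N) ((z ^ a) ^ x) (begin
    z ^ gcd a N ∙ (z ^ a) ^ x    ≈⟨ ∙-congˡ (^-* z a x) ⟩
    z ^ gcd a N ∙ z ^ (x * a)    ≈⟨ ^-+ z (gcd a N) (x * a) ⟨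
    z ^ (gcd a N + x * a)        ≡⟨ ≡.cong (z ^_) d+xa≡yN ⟩
    z ^ (y * N)                  ≈⟨ ^-∣ zᴺ≈ε (divides y ≡.refl) ⟩
    ε                            ∎))

  ^∣-∈⟨⟩ : ∀ g {m n} → m ∣ n → g ^ n ∈⟨ g ^ m ⟩
  ^∣-∈⟨⟩ g {m} (divides r ≡.refl) = ∈⟨⟩-resp (^-* g m r) (^∈⟨⟩ (g ^ m) r)

  -- With N the order of z and d = gcd a N, Bézout gives z ^ d ∈ ⟨z ^ a⟩; the (N / d)-th power
  -- kills z ^ a, hence z ^ b, so N ∣ (N / d) * b, i.e. d ∣ b.
  power∈⟨power⟩ : ∀ z a b → (∀ j → (z ^ a) ^ j ≈ ε → (z ^ b) ^ j ≈ ε) → z ^ b ∈⟨ z ^ a ⟩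
  power∈⟨power⟩ z a b annihilates with n , zᴺ≈ε , ord∣ ← order z =
    ∈⟨⟩-trans (^∣-∈⟨⟩ z d∣b) (gcd-power∈⟨power⟩ a zᴺ≈ε)
    where
    N = suc n
    d = gcd a N
    q = quotient (gcd[m,n]∣n a N)
    instance _ = quotient≢0 (gcd[m,n]∣n a N)
    N≡qd : N ≡.≡ q * d
    N≡qd = m∣n⇒n≡quotient*m (gcd[m,n]∣n a N)
    d∣b : d ∣ b
    d∣b = *-cancelˡ-∣ q (≡.subst (_∣ q * b) N≡qd (ord∣ (begin
      z ^ (q * b)    ≈⟨ ^-* z b q ⟨
      (z ^ b) ^ q    ≈⟨ annihilates q (begin
        (z ^ a) ^ q    ≈⟨ ^-* z a q ⟩
        z ^ (q * a)    ≈⟨ ^-∣ zᴺ≈ε (≡.subst (_∣ q * a) (≡.sym N≡qd) (*-monoʳ-∣ q (gcd[m,n]∣m a N))) ⟩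
        ε              ∎) ⟩
      ε              ∎)))

  order∣⇒∈⟨⟩ : ∀ {z g h} → g ∈⟨ z ⟩ → h ∈⟨ z ⟩ → (∀ j → g ^ j ≈ ε → h ^ j ≈ ε) → h ∈⟨ g ⟩
  order∣⇒∈⟨⟩ {z} {g} {h} g∈ h∈ annihilates
    with a , g≈zᵃ ← ∈⟨⟩⇒^ g∈ | b , h≈zᵇ ← ∈⟨⟩⇒^ h∈ =
      ∈⟨⟩-trans (∈⟨⟩-resp (sym h≈zᵇ) (power∈⟨power⟩ z a b annihilates′))
                (∈⟨⟩-resp g≈zᵃ (∈⟨⟩-refl g))
    where
    annihilates′ : ∀ j → (z ^ a) ^ j ≈ ε → (z ^ b) ^ j ≈ ε
    annihilates′ j zᵃʲ≈ε =
      trans (^-cong j (sym h≈zᵇ)) (annihilates j (trans (^-cong j g≈zᵃ) zᵃʲ≈ε))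

  CyclicSubgroupsNormal : Set (c ⊔ ℓ)
  CyclicSubgroupsNormal = ∀ x g → conj x g ∈⟨ g ⟩

  Dedekind⇒cyclicSubgroupsNormal : IsDedekind G → CyclicSubgroupsNormal
  Dedekind⇒cyclicSubgroupsNormal dedekind x g = dedekind (_∈⟨ g ⟩) InGen-isSubgroup x g (∈⟨⟩-refl g)

  cyclicSubgroupsNormal⇒Dedekind : CyclicSubgroupsNormal → IsDedekind G
  cyclicSubgroupsNormal⇒Dedekind normal H S x g g∈H = InGen-least S g∈H g∈H (normal x g)

  IsConjugate-refl : ∀ g → IsConjugate G g g
  IsConjugate-refl g = ε , sym (conj-identity g)

  IsConjugate-sym : ∀ {g h} → IsConjugate G g h → IsConjugate G h g
  IsConjugate-sym {g} {h} (y , g≈yhy⁻¹) =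
    y ⁻¹ , sym (trans (conj-congʳ (y ⁻¹) g≈yhy⁻¹) (conj-⁻¹-conj y h))

  module _ (normal : CyclicSubgroupsNormal) where

    conjugate∈⟨⟩ : ∀ {g h} → IsConjugate G g h → g ∈⟨ h ⟩
    conjugate∈⟨⟩ {h = h} (y , g≈yhy⁻¹) = ∈⟨⟩-resp (sym g≈yhy⁻¹) (normal y h)

    ∈⟨⟩-conjugation-invariant : ∀ {g g′ h h′} → IsConjugate G g′ g → IsConjugate G h′ h →
                                g′ ∈⟨ h′ ⟩ → g ∈⟨ h ⟩
    ∈⟨⟩-conjugation-invariant g′~g h′~h g′∈ =
      ∈⟨⟩-trans (conjugate∈⟨⟩ (IsConjugate-sym g′~g)) (∈⟨⟩-trans g′∈ (conjugate∈⟨⟩ h′~h))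

  module _ {r} (R : Carrier → Carrier → Set r) where

    sameGraph-of-conjugation-invariant :
      (∀ {g h} → g ≈ h → R g h) →
      (∀ {g g′ h h′} → IsConjugate G g′ g → IsConjugate G h′ h → R g′ h′ → R g h) →
      SameGraph G (Adj G R) (SuperAdj G R)
    sameGraph-of-conjugation-invariant R-reflexive R-invariant g h = Adj⇒SuperAdj , SuperAdj⇒Adj
      where
      Adj⇒SuperAdj : Adj G R g h → SuperAdj G R g h
      Adj⇒SuperAdj (g≉h , Rgh) = g≉h , g , h , IsConjugate-refl g , IsConjugate-refl h , inj₂ (g≉h , Rgh)
      SuperAdj⇒Adj : SuperAdj G R g h → Adj G R g h
      SuperAdj⇒Adj (g≉h , g′ , h′ , g′~g , h′~h , related) =
        g≉h , R-invariant g′~g h′~h ([ R-reflexive , proj₂ ]′ related)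

    sameGraph⇒cyclicSubgroupsNormal :
      (∀ {x g} → R g (conj x g) → conj x g ∈⟨ g ⟩) →
      SameGraph G (Adj G R) (SuperAdj G R) → CyclicSubgroupsNormal
    sameGraph⇒cyclicSubgroupsNormal R-conj⇒∈⟨⟩ same x g with g ≟ conj x g
    ... | yes g≈xgx⁻¹ = ∈⟨⟩-resp g≈xgx⁻¹ (∈⟨⟩-refl g)
    ... | no  g≉xgx⁻¹ = R-conj⇒∈⟨⟩ (proj₂ (proj₂ (same g (conj x g)) superAdjacent))
      where
      superAdjacent : SuperAdj G R g (conj x g)
      superAdjacent = g≉xgx⁻¹ , conj x g , conj x g , (x , refl) , IsConjugate-refl _ , inj₁ refl

  PowerRel⇒∈⟨⟩ : ∀ {g h} → PowerRel G g h → g ∈⟨ h ⟩ ⊎ h ∈⟨ g ⟩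
  PowerRel⇒∈⟨⟩ = Sum.map IsPowerOf⇒∈⟨⟩ IsPowerOf⇒∈⟨⟩

  ∈⟨⟩⇒PowerRel : ∀ {g h} → g ∈⟨ h ⟩ ⊎ h ∈⟨ g ⟩ → PowerRel G g h
  ∈⟨⟩⇒PowerRel = Sum.map ∈⟨⟩⇒IsPowerOf ∈⟨⟩⇒IsPowerOf

  PowerRel-reflexive : ∀ {g h} → g ≈ h → PowerRel G g h
  PowerRel-reflexive {h = h} g≈h = ∈⟨⟩⇒PowerRel (inj₁ (∈⟨⟩-resp (sym g≈h) (∈⟨⟩-refl h)))

  PowerRel-conjugation-invariant : CyclicSubgroupsNormal →
    ∀ {g g′ h h′} → IsConjugate G g′ g → IsConjugate G h′ h → PowerRel G g′ h′ → PowerRel G g h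
  PowerRel-conjugation-invariant normal g′~g h′~h =
    ∈⟨⟩⇒PowerRel ∘ Sum.map (∈⟨⟩-conjugation-invariant normal g′~g h′~h)
                            (∈⟨⟩-conjugation-invariant normal h′~h g′~g)
    ∘ PowerRel⇒∈⟨⟩

  PowerRel-conj⇒∈⟨⟩ : ∀ {x g} → PowerRel G g (conj x g) → conj x g ∈⟨ g ⟩
  PowerRel-conj⇒∈⟨⟩ = [ ∈⟨conj⟩⇒conj∈⟨⟩ , id ]′ ∘ PowerRel⇒∈⟨⟩

  ∈⟨⟩⇒InGenˡ : ∀ {a b x} → x ∈⟨ a ⟩ → InGen G a b x
  ∈⟨⟩⇒InGenˡ = InGen-least InGen-isSubgroup (gen₁ refl) (gen₁ refl)

  ∈⟨⟩⇒InGenʳ : ∀ {a b x} → x ∈⟨ b ⟩ → InGen G a b x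
  ∈⟨⟩⇒InGenʳ = InGen-least InGen-isSubgroup (gen₂ refl) (gen₂ refl)

  GenCyclic-resp : ∀ {a b c d} → InGen G a b ⊆ InGen G c d → InGen G c d ⊆ InGen G a b →
                   GenCyclic G a b → GenCyclic G c d
  GenCyclic-resp ab⊆cd cd⊆ab (z , z∈ , generates) = z , ab⊆cd z∈ , λ x → generates x ∘ cd⊆ab

  GenCyclic-reflexive : ∀ {g h} → g ≈ h → GenCyclic G g h
  GenCyclic-reflexive {g} g≈h =
    g , gen₁ refl , λ x → ∈⟨⟩⇒IsPowerOf ∘ InGen-least InGen-isSubgroup (∈⟨⟩-refl g) (gen₁ (sym g≈h))

  GenCyclic-conjugation-invariant : CyclicSubgroupsNormal →
    ∀ {g g′ h h′} → IsConjugate G g′ g → IsConjugate G h′ h → GenCyclic G g′ h′ → GenCyclic G g h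
  GenCyclic-conjugation-invariant normal g′~g h′~h = GenCyclic-resp
    (InGen-least InGen-isSubgroup (∈⟨⟩⇒InGenˡ (conjugate∈⟨⟩ normal g′~g))
                                  (∈⟨⟩⇒InGenʳ (conjugate∈⟨⟩ normal h′~h)))
    (InGen-least InGen-isSubgroup (∈⟨⟩⇒InGenˡ (conjugate∈⟨⟩ normal (IsConjugate-sym g′~g)))
                                  (∈⟨⟩⇒InGenʳ (conjugate∈⟨⟩ normal (IsConjugate-sym h′~h))))

  GenCyclic-conj⇒∈⟨⟩ : ∀ {x g} → GenCyclic G g (conj x g) → conj x g ∈⟨ g ⟩
  GenCyclic-conj⇒∈⟨⟩ {x} {g} (z , _ , generates) =
    order∣⇒∈⟨⟩ (IsPowerOf⇒∈⟨⟩ (generates g (gen₁ refl))) (IsPowerOf⇒∈⟨⟩ (generates _ (gen₂ refl)))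
      λ j gʲ≈ε → trans (sym (conj-^ x g j)) (trans (conj-congʳ x gʲ≈ε) (conj-ε x))

mainTheorem4 : ∀ {c ℓ : Level} (G : FiniteGroup c ℓ) →
    ((PowerGraph≡SuperPowerGraph G → IsDedekind G) × (IsDedekind G → PowerGraph≡SuperPowerGraph G))
    × ((EnhancedPowerGraph≡SuperEnhancedPowerGraph G → IsDedekind G)
    × (IsDedekind G → EnhancedPowerGraph≡SuperEnhancedPowerGraph G))
mainTheorem4 G =
  ( cyclicSubgroupsNormal⇒Dedekind ∘ sameGraph⇒cyclicSubgroupsNormal (PowerRel G) PowerRel-conj⇒∈⟨⟩
  , λ dedekind → sameGraph-of-conjugation-invariant (PowerRel G) PowerRel-reflexive
      (PowerRel-conjugation-invariant (Dedekind⇒cyclicSubgroupsNormal dedekind)) )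
  , ( cyclicSubgroupsNormal⇒Dedekind ∘ sameGraph⇒cyclicSubgroupsNormal (EnhancedRel G) GenCyclic-conj⇒∈⟨⟩
    , λ dedekind → sameGraph-of-conjugation-invariant (EnhancedRel G) GenCyclic-reflexive
        (GenCyclic-conjugation-invariant (Dedekind⇒cyclicSubgroupsNormal dedekind)) )
  where open Properties G
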